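{- Every orthogonal Boolean poset $\mathbf P=(P,\leq,{}',0,1)$ (whose involution ${}'$ is its complementation) is orthomodular.
   Context: For a poset $(P,\leq)$ and $A\subseteq P$: $L(A)=\{x: x\leq a\ \forall a\in A\}$, $U(A)=\{x: a\leq x\ \forall a\in A\}$, $L(x,y)=L(\{x,y\})$, $U(x,y)=U(\{x,y\})$, $LU(A)=L(U(A))$. A bounded poset $(P,\leq,{}',0,1)$ with antitone involution: $x\leq y\Rightarrow y'\leq x'$, $x''=x$. $x\perp y$ iff $x\leq y'$. Orthogonal: $x\perp y$ implies the supremum $x\vee y$ exists. A poset is distributive if $L(U(x,y),z)=LU(L(x,z),L(y,z))$ for all $x,y,z$; complemented if each $x$ has some $y$ with $L(x,y)=L(P)$ and $U(x,y)=U(P)$; Boolean if distributive and complemented (complements are then unique). Orthomodular poset: orthogonal poset such that $x\leq y$ implies $x\vee(y\wedge x')=y$ (here $y\wedge x'=(y'\vee x)'$ exists). -}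

module Defs where

open import Level using (Level; _⊔_; Lift)
open import Data.Product using (Σ; Σ-syntax; _×_; _,_)
open import Data.Sum using (_⊎_)
open import Data.Unit using (⊤)
open import Relation.Unary using (Pred; _≐_; _∪_)
open import Relation.Binary.Bundles using (Poset)

-- Subsets of P are predicates on the carrier
-- at the single level c ⊔ ℓ₁ ⊔ ℓ₂; equality of subsets is _≐_
-- (mutual inclusion).
module _ {c ℓ₁ ℓ₂ : Level} (P : Poset c ℓ₁ ℓ₂) where
  open Poset P renaming (Carrier to A)

  Subset : Set _
  Subset = Pred A (c ⊔ ℓ₁ ⊔ ℓ₂)

  Lo : Subset → Subset
  Lo S x = Lift (c ⊔ ℓ₁ ⊔ ℓ₂) (∀ a → S a → x ≤ a)

  Up : Subset → Subset
  Up S x = Lift (c ⊔ ℓ₁ ⊔ ℓ₂) (∀ a → S a → a ≤ x)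

  single : A → Subset
  single x z = Lift (c ⊔ ℓ₁ ⊔ ℓ₂) (z ≈ x)

  pair : A → A → Subset
  pair x y = single x ∪ single y

  whole : Subset
  whole _ = Lift (c ⊔ ℓ₁ ⊔ ℓ₂) ⊤

  Lo₂ : A → A → Subset
  Lo₂ x y = Lo (pair x y)

  Up₂ : A → A → Subset
  Up₂ x y = Up (pair x y)

  -- distributive: L(U(x,y),z) = LU(L(x,z),L(y,z)),
  -- where L(U(x,y),z) = L(U(x,y) ∪ {z}) and
  -- LU(L(x,z),L(y,z)) = L(U(L(x,z) ∪ L(y,z))).
  IsDistributive : Set _
  IsDistributive = ∀ x y z →
    Lo (Up₂ x y ∪ single z) ≐ Lo (Up (Lo₂ x z ∪ Lo₂ y z))

  IsComplementOf : A → A → Set _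
  IsComplementOf y x = (Lo₂ x y ≐ Lo whole) × (Up₂ x y ≐ Up whole)

  IsComplemented : Set _
  IsComplemented = ∀ x → Σ[ y ∈ A ] IsComplementOf y x

  IsBoolean : Set _
  IsBoolean = IsDistributive × IsComplemented

  IsSup : A → A → A → Set _
  IsSup x y s = x ≤ s × y ≤ s × (∀ u → x ≤ u → y ≤ u → s ≤ u)

  IsInf : A → A → A → Set _
  IsInf x y i = i ≤ x × i ≤ y × (∀ u → u ≤ x → u ≤ y → u ≤ i)

record BoundedInvPoset (c ℓ₁ ℓ₂ : Level) : Set (Level.suc (c ⊔ ℓ₁ ⊔ ℓ₂)) where
  field
    poset : Poset c ℓ₁ ℓ₂
  open Poset poset public renaming (Carrier to A)
  field
    _′ : A → A
    𝟎 𝟏 : A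
    𝟎-least : ∀ x → 𝟎 ≤ x
    𝟏-greatest : ∀ x → x ≤ 𝟏
    antitone : ∀ {x y} → x ≤ y → y ′ ≤ x ′
    involutive : ∀ x → x ′ ′ ≈ x

  _⊥_ : A → A → Set ℓ₂
  x ⊥ y = x ≤ y ′

  IsOrthogonal : Set _
  IsOrthogonal = ∀ x y → x ⊥ y → Σ[ s ∈ A ] IsSup poset x y s

  InvolutionIsComplementation : Set _
  InvolutionIsComplementation = ∀ x → IsComplementOf poset (x ′) x

  -- orthomodular: orthogonal, and x ≤ y implies x ∨ (y ∧ x') = y.
  -- Here y ∧ x' (which exists by orthogonality, as (y' ∨ x)') is any
  -- infimum m of y and x' (infima are unique up to ≈), and the equation
  -- x ∨ m = y says exactly that y is a supremum of x and m.
  IsOrthomodular : Set _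
  IsOrthomodular = IsOrthogonal ×
    (∀ x y → x ≤ y → ∀ m → IsInf poset y (x ′) m → IsSup poset x m y)

-- Let x ≤ y and let m be an infimum of y and x′. Every upper bound of the
-- complementary pair x, x′ is a top element, so y lies in L(U(x,x′), y),
-- which by distributivity is LU(L(x,y), L(x′,y)). An upper bound u of x and m
-- bounds L(x,y) (below x) and L(x′,y) (below their infimum m), hence y ≤ u.
module Submission where

open import Defs
open import Level using (Level; lift; lower)
open import Data.Product using (_,_; proj₁)
open import Data.Sum using (_⊎_; inj₁; inj₂; [_,_])
open import Relation.Binary.Bundles using (Poset)

module _ {c ℓ₁ ℓ₂ : Level} (P : Poset c ℓ₁ ℓ₂) where
  open Poset P renaming (Carrier to A)

  Lo₂-≤ˡ : ∀ {a b w} → Lo₂ P a b w → w ≤ a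
  Lo₂-≤ˡ w∈L = lower w∈L _ (inj₁ (lift Eq.refl))

  Lo₂-≤ʳ : ∀ {a b w} → Lo₂ P a b w → w ≤ b
  Lo₂-≤ʳ w∈L = lower w∈L _ (inj₂ (lift Eq.refl))

  Lo₂-≤-inf : ∀ {a b i w} → IsInf P a b i → Lo₂ P b a w → w ≤ i
  Lo₂-≤-inf (_ , _ , greatest) w∈L = greatest _ (Lo₂-≤ʳ w∈L) (Lo₂-≤ˡ w∈L)

  complement-Lo-Up₂∪single : ∀ {x z} → IsComplementOf P z x →
                             ∀ y → Lo P (λ w → Up₂ P x z w ⊎ single P y w) y
  complement-Lo-Up₂∪single (_ , U≐UP , _) y = lift λ a →
    [ (λ a∈U → lower (U≐UP a∈U) y (lift _))
    , (λ a≈y → reflexive (Eq.sym (lower a≈y))) ]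

  distributive-sup-relativeComplement :
    IsDistributive P → ∀ {x z} → IsComplementOf P z x →
    ∀ {y} → x ≤ y → ∀ {m} → IsInf P y z m → IsSup P x m y
  distributive-sup-relativeComplement
    dist {x} {z} z-compl {y} x≤y {m} m-inf@(m≤y , _) = x≤y , m≤y , least
    where
    y∈LU : Lo P (Up P (λ w → Lo₂ P x y w ⊎ Lo₂ P z y w)) y
    y∈LU = proj₁ (dist x z y) (complement-Lo-Up₂∪single z-compl y)

    least : ∀ u → x ≤ u → m ≤ u → y ≤ u
    least u x≤u m≤u = lower y∈LU u (lift λ w →
      [ (λ w∈Lxy → trans (Lo₂-≤ˡ w∈Lxy) x≤u)
      , (λ w∈Lzy → trans (Lo₂-≤-inf m-inf w∈Lzy) m≤u) ])

lemma1 : ∀ {c ℓ₁ ℓ₂} (P : BoundedInvPoset c ℓ₁ ℓ₂) →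
    let open BoundedInvPoset P in
    IsOrthogonal → IsBoolean poset → InvolutionIsComplementation →
    IsOrthomodular
lemma1 P orth (dist , _) ′-compl = orth , λ x y x≤y m m-inf →
  distributive-sup-relativeComplement poset dist (′-compl x) x≤y m-inf
  where open BoundedInvPoset P
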